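{- Let $u$ be any sequence of the form $a v a v' a$ such that $a$ is a letter, $v$ is a nonempty sequence not containing $a$ with no repeated letters, and $v'$ is a permutation of $v$ which can be obtained from $v$ neither by only moving the first letter of $v$ to another place in $v$ nor by only moving a single letter of $v$ to the end of $v$. Then $\mathit{fw}(u)>4$.
   Context: A sequence $s$ contains a sequence $u$ if some subsequence of $s$ can be changed into $u$ by a one-to-one renaming of its letters. An $(r,s)$-formation is a concatenation of $s$ permutations of the same set of $r$ distinct letters. The formation width $\mathit{fw}(u)$ is the minimum $s$ such that there exists $r$ for which every $(r,s)$-formation contains $u$. -}

module Defs where

open import Data.Nat using (ℕ; _≤_; _>_)
open import Data.List using (List; []; _∷_; _++_; [_]; length; map; concat)
open import Data.List.Membership.Propositional using (_∈_; _∉_)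
open import Data.List.Relation.Unary.All using (All)
open import Data.List.Relation.Unary.Unique.Propositional using (Unique)
open import Data.List.Relation.Binary.Sublist.Propositional using (_⊆_)
open import Data.List.Relation.Binary.Permutation.Propositional using (_↭_)
open import Data.Product using (Σ; _×_; ∃; ∃-syntax)
open import Relation.Binary.PropositionalEquality using (_≡_)
open import Relation.Nullary using (¬_)

Seq : Set
Seq = List ℕ

Contains : Seq → Seq → Set
Contains s u =
  ∃[ w ] (w ⊆ s × ∃[ f ] (map f w ≡ u ×
    (∀ {x y} → x ∈ w → y ∈ w → f x ≡ f y → x ≡ y)))

IsFormation : ℕ → ℕ → Seq → Set
IsFormation r s f =
  ∃[ L ] (length L ≡ r × Unique L ×
    ∃[ ps ] (length ps ≡ s × All (_↭ L) ps × f ≡ concat ps))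

AllFormationsContain : ℕ → ℕ → Seq → Set
AllFormationsContain r s u = ∀ f → IsFormation r s f → Contains f u

FwGreaterThan : Seq → ℕ → Set
FwGreaterThan u k = ¬ (∃[ s ] (s ≤ k × ∃[ r ] AllFormationsContain r s u))

MoveFirst : Seq → Seq → Set
MoveFirst v v' =
  ∃[ x ] ∃[ ys ] ∃[ zs ] (v ≡ x ∷ (ys ++ zs) × v' ≡ ys ++ (x ∷ zs))

MoveToEnd : Seq → Seq → Set
MoveToEnd v v' =
  ∃[ ys ] ∃[ x ] ∃[ zs ] (v ≡ ys ++ (x ∷ zs) × v' ≡ ys ++ zs ++ [ x ])

-- A prefix of a formation is a formation, so it suffices to show that for every r the width-4
-- formations L L L L and L R R L, where L = 0 1 ⋯ r-1 and R is its reverse, do not both contain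
-- u.  A subsequence of L L L L has at most three non-ascents, while a triple x y z of v reversed
-- in v' would yield the pattern b x y z b z y x b, which has four; so v' reverses no triple of v.
-- In L R R L every letter b occurs once per block, so the three copies of a land on three of the
-- four copies of b: either v is placed in the part of L R above b, which rules out a Peak, or v'
-- is placed in the part of R L below b, which rules out a Valley.  Finally, when no triple is
-- reversed, a v' without Peak arises from v by moving its first letter, and a v' without Valley
-- by moving one letter to the end.

module Submission where

open import Defs
open import Level using (Level)
open import Function using (id)
open import Data.Empty using (⊥; ⊥-elim)
open import Data.Product using (_×_; _,_; proj₂; ∃-syntax; ∃₂)
open import Data.Sum using (_⊎_; inj₁; inj₂)
open import Data.Nat using (ℕ; suc; _+_; _≤_; _<_; _>_; _≤?_; _≟_; z≤n; s≤s)
open import Data.Nat.Properties using (<-irrefl; ≤-total; ≤-refl; ≤-reflexive; <⇒≱; <-asym; +-monoˡ-≤; +-monoʳ-≤; +-mono-≤; +-assoc; n≤1+n; m≤n⇒m⊓n≡m; module ≤-Reasoning)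
open import Data.Nat.Tactic.RingSolver using (solve-∀)
open import Data.List using (List; []; _∷_; _++_; [_]; length; map; concat; take; drop; upTo; downFrom; initLast; _∷ʳ′_)
open import Data.List.Properties using (++-assoc; ++-identityʳ; map-++; concat-++; take++drop≡id; length-take; length-upTo; reverse-upTo; ++-monoid)
open import Data.List.Membership.Propositional using (_∈_; _∉_)
open import Data.List.Membership.Propositional.Properties using (∈-++⁺ˡ; ∈-++⁺ʳ; ∈-++⁻; ∈-∃++; ∈-map⁺; ∈-map⁻)
open import Data.List.Relation.Unary.Any using (here; there)
open import Data.List.Relation.Unary.All as All using (All; []; _∷_)
import Data.List.Relation.Unary.All.Properties as All
open import Data.List.Relation.Unary.AllPairs using (AllPairs; []; _∷_)
import Data.List.Relation.Unary.AllPairs.Properties as AllPairs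
open import Data.List.Relation.Unary.Unique.Propositional using (Unique)
open import Data.List.Relation.Unary.Unique.Propositional.Properties using (upTo⁺)
open import Data.List.Relation.Binary.Sublist.Propositional using (_⊆_; []; _∷_; _∷ʳ_; ⊆-refl; ⊆-trans; from∈)
open import Data.List.Relation.Binary.Sublist.Propositional.Properties using (++⁺; ++⁺ʳ; ∷ˡ⁻; map⁺; []⊆-universal; All-resp-⊆; Any-resp-⊆)
open import Data.List.Relation.Binary.Permutation.Propositional using (_↭_; ↭-refl; ↭-sym; ↭-trans; ↭⇒↭ₛ)
open import Data.List.Relation.Binary.Permutation.Propositional.Properties using (∈-resp-↭; drop-∷; drop-mid; ↭-length; ↭-reverse)
  renaming (++-identityʳ to ↭-++-identityʳ)
import Data.List.Relation.Binary.Permutation.Setoid.Properties as Permutationₛ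
open import Relation.Binary.PropositionalEquality using (_≡_; _≢_; refl; sym; trans; cong; cong₂; subst; subst₂; setoid)
open import Relation.Nullary using (¬_; yes; no)
open import Relation.Unary using (Pred)
open import Algebra.Solver.Monoid (++-monoid ℕ) using (solve; _⊜_; _⊕_) renaming (id to ε)

private
  variable
    a ℓ : Level
    A : Set a
    x y z b : A
    xs ys zs ws : List A

⊆-++-split : ∀ xs → zs ⊆ xs ++ ys → ∃₂ λ zs₁ zs₂ → zs ≡ zs₁ ++ zs₂ × zs₁ ⊆ xs × zs₂ ⊆ ys
⊆-++-split [] τ = [] , _ , refl , [] , τ
⊆-++-split (x ∷ xs) (.x ∷ʳ τ) with ⊆-++-split xs τ
... | zs₁ , zs₂ , refl , τ₁ , τ₂ = zs₁ , zs₂ , refl , x ∷ʳ τ₁ , τ₂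
⊆-++-split (x ∷ xs) (refl ∷ τ) with ⊆-++-split xs τ
... | zs₁ , zs₂ , refl , τ₁ , τ₂ = x ∷ zs₁ , zs₂ , refl , refl ∷ τ₁ , τ₂

triple-⊆-++ : ∀ xs → x ∷ y ∷ z ∷ [] ⊆ xs ++ ys → (x ∷ y ∷ [] ⊆ xs) ⊎ (y ∷ z ∷ [] ⊆ ys)
triple-⊆-++ xs τ with ⊆-++-split xs τ
... | []                , _ , refl , _  , τ₂ = inj₂ (∷ˡ⁻ τ₂)
... | _ ∷ []            , _ , refl , _  , τ₂ = inj₂ τ₂
... | _ ∷ _ ∷ []        , _ , refl , τ₁ , _  = inj₁ τ₁
... | _ ∷ _ ∷ _ ∷ []    , _ , refl , τ₁ , _  = inj₁ (⊆-trans (refl ∷ refl ∷ []⊆-universal _) τ₁)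

⊆-skip-middle : x ∷ y ∷ z ∷ [] ⊆ xs → x ∷ z ∷ [] ⊆ xs
⊆-skip-middle = ⊆-trans (refl ∷ _ ∷ʳ refl ∷ [])

⊆-drop-last : x ∷ y ∷ z ∷ [] ⊆ xs → x ∷ y ∷ [] ⊆ xs
⊆-drop-last = ⊆-trans (refl ∷ refl ∷ _ ∷ʳ [])

module _ {R : A → A → Set ℓ} where

  AllPairs-resp-⊆ : ys ⊆ xs → AllPairs R xs → AllPairs R ys
  AllPairs-resp-⊆ []         []         = []
  AllPairs-resp-⊆ (_ ∷ʳ τ)   (_ ∷ rxs)  = AllPairs-resp-⊆ τ rxs
  AllPairs-resp-⊆ (refl ∷ τ) (rx ∷ rxs) = All-resp-⊆ τ rx ∷ AllPairs-resp-⊆ τ rxs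

  AllPairs-pair : x ∷ y ∷ [] ⊆ xs → AllPairs R xs → R x y
  AllPairs-pair τ rxs with AllPairs-resp-⊆ τ rxs
  ... | (rxy ∷ []) ∷ _ = rxy

  AllPairs-split : AllPairs R xs → x ∈ xs →
    ∃₂ λ ys zs → xs ≡ ys ++ x ∷ zs × All (λ y → R y x) ys × All (R x) zs × AllPairs R ys × AllPairs R zs
  AllPairs-split (rx ∷ rxs) (here refl) = [] , _ , refl , [] , rx , [] , rxs
  AllPairs-split (rx ∷ rxs) (there x∈) with AllPairs-split rxs x∈
  ... | ys , zs , refl , rys , rzs , ↑ys , ↑zs =
    _ ∷ ys , zs , refl , All.lookup rx x∈ ∷ rys , rzs , All.++⁻ˡ ys rx ∷ ↑ys , ↑zs

⊆-remove-pivot : ∀ xs → b ∉ ws → ws ⊆ xs ++ b ∷ ys → ws ⊆ xs ++ ys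
⊆-remove-pivot []       b∉ws (_ ∷ʳ τ)     = τ
⊆-remove-pivot []       b∉ws (refl ∷ τ)   = ⊥-elim (b∉ws (here refl))
⊆-remove-pivot (x ∷ xs) b∉ws (.x ∷ʳ τ)    = x ∷ʳ ⊆-remove-pivot xs b∉ws τ
⊆-remove-pivot (x ∷ xs) b∉ws (refl ∷ τ)   = refl ∷ ⊆-remove-pivot xs (λ b∈ → b∉ws (there b∈)) τ

⊆-past-pivot : ∀ xs → b ∉ xs → b ∷ zs ⊆ xs ++ b ∷ ys → zs ⊆ ys
⊆-past-pivot []       b∉xs (_ ∷ʳ τ)   = ∷ˡ⁻ τ
⊆-past-pivot []       b∉xs (refl ∷ τ) = τ
⊆-past-pivot (x ∷ xs) b∉xs (.x ∷ʳ τ)  = ⊆-past-pivot xs (λ b∈ → b∉xs (there b∈)) τ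
⊆-past-pivot (x ∷ xs) b∉xs (refl ∷ τ) = ⊥-elim (b∉xs (here refl))

⊆-before-pivot : ∀ xs → b ∉ ys → ws ++ [ b ] ⊆ xs ++ b ∷ ys → ws ⊆ xs
⊆-before-pivot {ws = []}     xs       b∉ys τ          = []⊆-universal xs
⊆-before-pivot {ws = w ∷ ws} []       b∉ys (_ ∷ʳ τ)   = ⊥-elim (b∉ys (Any-resp-⊆ τ (∈-++⁺ʳ (w ∷ ws) (here refl))))
⊆-before-pivot {ws = w ∷ ws} []       b∉ys (refl ∷ τ) = ⊥-elim (b∉ys (Any-resp-⊆ τ (∈-++⁺ʳ ws (here refl))))
⊆-before-pivot {ws = w ∷ ws} (x ∷ xs) b∉ys (.x ∷ʳ τ)  = x ∷ʳ ⊆-before-pivot xs b∉ys τ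
⊆-before-pivot {ws = w ∷ ws} (x ∷ xs) b∉ys (refl ∷ τ) = refl ∷ ⊆-before-pivot xs b∉ys τ

⊆-pivot : ∀ xs → b ∉ ws → b ∉ xs → ws ++ b ∷ zs ⊆ xs ++ b ∷ ys →
  (ws ⊆ xs × zs ⊆ ys) ⊎ (ws ++ b ∷ zs ⊆ xs ++ ys)
⊆-pivot {ws = []}     []       _    _    (_ ∷ʳ τ)   = inj₂ τ
⊆-pivot {ws = []}     []       _    _    (refl ∷ τ) = inj₁ ([] , τ)
⊆-pivot {ws = w ∷ ws} []       _    _    (_ ∷ʳ τ)   = inj₂ τ
⊆-pivot {ws = w ∷ ws} []       b∉ws _    (refl ∷ τ) = ⊥-elim (b∉ws (here refl))
⊆-pivot {ws = []}     (x ∷ xs) _    b∉xs (refl ∷ τ) = ⊥-elim (b∉xs (here refl))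
⊆-pivot               (x ∷ xs) b∉ws b∉xs (.x ∷ʳ τ) with ⊆-pivot xs b∉ws (λ b∈ → b∉xs (there b∈)) τ
... | inj₁ (τ₁ , τ₂) = inj₁ (x ∷ʳ τ₁ , τ₂)
... | inj₂ τ′        = inj₂ (x ∷ʳ τ′)
⊆-pivot {ws = w ∷ ws} (x ∷ xs) b∉ws b∉xs (refl ∷ τ)
  with ⊆-pivot xs (λ b∈ → b∉ws (there b∈)) (λ b∈ → b∉xs (there b∈)) τ
... | inj₁ (τ₁ , τ₂) = inj₁ (refl ∷ τ₁ , τ₂)
... | inj₂ τ′        = inj₂ (refl ∷ τ′)

∉-++ : x ∉ xs → x ∉ ys → x ∉ xs ++ ys
∉-++ {xs = xs} x∉xs x∉ys x∈ with ∈-++⁻ xs x∈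
... | inj₁ x∈xs = x∉xs x∈xs
... | inj₂ x∈ys = x∉ys x∈ys

∉-resp-⊆ : xs ⊆ ys → b ∉ ys → b ∉ xs
∉-resp-⊆ τ b∉ys b∈xs = b∉ys (Any-resp-⊆ τ b∈xs)

⊆-four-pivots : ∀ X₀ X₁ X₂ X₃ {X₄ w₁ w₂} → b ∉ w₁ → b ∉ w₂ →
  b ∉ X₀ → b ∉ X₁ → b ∉ X₂ → b ∉ X₃ → b ∉ X₄ →
  b ∷ w₁ ++ b ∷ w₂ ++ [ b ] ⊆ X₀ ++ b ∷ X₁ ++ b ∷ X₂ ++ b ∷ X₃ ++ b ∷ X₄ →
  (w₁ ⊆ X₁ × w₂ ⊆ X₂ ++ X₃) ⊎ (w₁ ⊆ X₁ ++ X₂ × w₂ ⊆ X₃)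
⊆-four-pivots {b = b} X₀ X₁ X₂ X₃ {X₄} {w₁} {w₂} b∉w₁ b∉w₂ b∉X₀ b∉X₁ b∉X₂ b∉X₃ b∉X₄ τ
  with ⊆-pivot X₁ b∉w₁ b∉X₁ (⊆-past-pivot X₀ b∉X₀ τ)
... | inj₁ (τ₁ , τ₂) = inj₁ (τ₁ , ⊆-remove-pivot X₂ b∉w₂ (⊆-before-pivot (X₂ ++ b ∷ X₃) b∉X₄
        (subst (w₂ ++ [ b ] ⊆_) (sym (++-assoc X₂ (b ∷ X₃) (b ∷ X₄))) τ₂)))
... | inj₂ τ₂ with ⊆-pivot (X₁ ++ X₂) b∉w₁ (∉-++ b∉X₁ b∉X₂) (subst (_ ⊆_) (sym (++-assoc X₁ X₂ _)) τ₂)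
...   | inj₁ (τ₃ , τ₄) = inj₂ (τ₃ , ⊆-before-pivot X₃ b∉X₄ τ₄)
...   | inj₂ τ₄ with ⊆-pivot ((X₁ ++ X₂) ++ X₃) b∉w₁ (∉-++ (∉-++ b∉X₁ b∉X₂) b∉X₃)
                    (subst (_ ⊆_) (sym (++-assoc (X₁ ++ X₂) X₃ _)) τ₄)
...     | inj₁ (_ , τ₅) = ⊥-elim (∉-resp-⊆ τ₅ b∉X₄ (∈-++⁺ʳ w₂ (here refl)))
...     | inj₂ τ₅       = ⊥-elim (∉-resp-⊆ τ₅ (∉-++ (∉-++ (∉-++ b∉X₁ b∉X₂) b∉X₃) b∉X₄) (∈-++⁺ʳ w₁ (here refl)))

module _ {P Q : Pred A ℓ} (P⇒¬Q : ∀ {x} → P x → ¬ Q x) where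

  ⊆-++-dropˡ : ∀ xs → All Q xs → All P ws → ws ⊆ xs ++ ys → ws ⊆ ys
  ⊆-++-dropˡ []       _          _          τ          = τ
  ⊆-++-dropˡ (x ∷ xs) (_ ∷ qxs)  pws        (.x ∷ʳ τ)  = ⊆-++-dropˡ xs qxs pws τ
  ⊆-++-dropˡ (x ∷ xs) (qx ∷ _)   (px ∷ _)   (refl ∷ τ) = ⊥-elim (P⇒¬Q px qx)

  ⊆-++-dropʳ : ∀ xs → All Q ys → All P ws → ws ⊆ xs ++ ys → ws ⊆ xs
  ⊆-++-dropʳ {ws = []}    []       _   _          _          = []
  ⊆-++-dropʳ {ws = w ∷ _} []       qys (pw ∷ _)   τ          = ⊥-elim (P⇒¬Q pw (All.lookup qys (Any-resp-⊆ τ (here refl))))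
  ⊆-++-dropʳ              (x ∷ xs) qys pws        (.x ∷ʳ τ)  = x ∷ʳ ⊆-++-dropʳ xs qys pws τ
  ⊆-++-dropʳ              (x ∷ xs) qys (_ ∷ pws)  (refl ∷ τ) = refl ∷ ⊆-++-dropʳ xs qys pws τ

  ⊆-++-middle : ∀ xs → All Q xs → All Q zs → All P ws → ws ⊆ xs ++ ys ++ zs → ws ⊆ ys
  ⊆-++-middle xs qxs qzs pws τ = ⊆-++-dropʳ _ qzs pws (⊆-++-dropˡ xs qxs pws τ)

Unique-resp-↭ : xs ↭ ys → Unique xs → Unique ys
Unique-resp-↭ p = Permutationₛ.Unique-resp-↭ (setoid _) (↭⇒↭ₛ p)

∈-concat-↭ : ∀ {L : List A} {ps} → All (_↭ L) ps → x ∈ concat ps → x ∈ L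
∈-concat-↭ {ps = p ∷ _} (p↭L ∷ ps↭L) x∈ with ∈-++⁻ p x∈
... | inj₁ x∈p = ∈-resp-↭ p↭L x∈p
... | inj₂ x∈ps = ∈-concat-↭ ps↭L x∈ps

⊆-pair-or-swapped : x ∈ xs → y ∈ xs → x ≢ y → (x ∷ y ∷ [] ⊆ xs) ⊎ (y ∷ x ∷ [] ⊆ xs)
⊆-pair-or-swapped (here refl) (here refl) x≢y = ⊥-elim (x≢y refl)
⊆-pair-or-swapped (here refl) (there y∈)  _   = inj₁ (refl ∷ from∈ y∈)
⊆-pair-or-swapped (there x∈)  (here refl) _   = inj₂ (refl ∷ from∈ x∈)
⊆-pair-or-swapped {xs = z ∷ _} (there x∈) (there y∈) x≢y with ⊆-pair-or-swapped x∈ y∈ x≢y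
... | inj₁ τ = inj₁ (z ∷ʳ τ)
... | inj₂ τ = inj₂ (z ∷ʳ τ)

module _ {A : Set a} where

  data Order₃ (x y z : A) (xs : List A) : Set a where
    xyz : x ∷ y ∷ z ∷ [] ⊆ xs → Order₃ x y z xs
    xzy : x ∷ z ∷ y ∷ [] ⊆ xs → Order₃ x y z xs
    yxz : y ∷ x ∷ z ∷ [] ⊆ xs → Order₃ x y z xs
    yzx : y ∷ z ∷ x ∷ [] ⊆ xs → Order₃ x y z xs
    zxy : z ∷ x ∷ y ∷ [] ⊆ xs → Order₃ x y z xs
    zyx : z ∷ y ∷ x ∷ [] ⊆ xs → Order₃ x y z xs

  order₃ : {x y z : A} {xs : List A} → x ∈ xs → y ∈ xs → z ∈ xs → x ≢ y → x ≢ z → y ≢ z → Order₃ x y z xs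
  order₃ (here refl) (here refl) _           x≢y _   _   = ⊥-elim (x≢y refl)
  order₃ (here refl) _           (here refl) _   x≢z _   = ⊥-elim (x≢z refl)
  order₃ _           (here refl) (here refl) _   _   y≢z = ⊥-elim (y≢z refl)
  order₃ (here refl) (there y∈)  (there z∈)  _   _   y≢z with ⊆-pair-or-swapped y∈ z∈ y≢z
  ... | inj₁ τ = xyz (refl ∷ τ)
  ... | inj₂ τ = xzy (refl ∷ τ)
  order₃ (there x∈)  (here refl) (there z∈)  _   x≢z _   with ⊆-pair-or-swapped x∈ z∈ x≢z
  ... | inj₁ τ = yxz (refl ∷ τ)
  ... | inj₂ τ = yzx (refl ∷ τ)
  order₃ (there x∈)  (there y∈)  (here refl) x≢y _   _   with ⊆-pair-or-swapped x∈ y∈ x≢y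
  ... | inj₁ τ = zxy (refl ∷ τ)
  ... | inj₂ τ = zyx (refl ∷ τ)
  order₃ {xs = w ∷ _} (there x∈) (there y∈) (there z∈) x≢y x≢z y≢z with order₃ x∈ y∈ z∈ x≢y x≢z y≢z
  ... | xyz τ = xyz (w ∷ʳ τ)
  ... | xzy τ = xzy (w ∷ʳ τ)
  ... | yxz τ = yxz (w ∷ʳ τ)
  ... | yzx τ = yzx (w ∷ʳ τ)
  ... | zxy τ = zxy (w ∷ʳ τ)
  ... | zyx τ = zyx (w ∷ʳ τ)

↭-pairs-preserved⇒≡ : Unique xs → xs ↭ ys → (∀ {q r} → q ∷ r ∷ [] ⊆ xs → q ∷ r ∷ [] ⊆ ys) → xs ≡ ys
↭-pairs-preserved⇒≡ {xs = []}    {ys = []}    _ _ _ = refl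
↭-pairs-preserved⇒≡ {xs = []}    {ys = y ∷ _} _ p _ with ∈-resp-↭ (↭-sym p) (here refl)
... | ()
↭-pairs-preserved⇒≡ {xs = x ∷ _} {ys = []}    _ p _ with ∈-resp-↭ p (here refl)
... | ()
↭-pairs-preserved⇒≡ {xs = x ∷ xs} {ys = y ∷ ys} u@(x∉xs ∷ uxs) p pairs with ∈-resp-↭ p (here refl)
... | here refl = cong (x ∷_) (↭-pairs-preserved⇒≡ uxs (drop-∷ p) pairs′)
  where
  pairs′ : ∀ {q r} → q ∷ r ∷ [] ⊆ xs → q ∷ r ∷ [] ⊆ ys
  pairs′ τ with pairs (x ∷ʳ τ)
  ... | _ ∷ʳ τ′  = τ′
  ... | refl ∷ _ = ⊥-elim (All.lookup x∉xs (Any-resp-⊆ τ (here refl)) refl)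
... | there x∈ys with Unique-resp-↭ p u | ∈-resp-↭ (↭-sym p) (here refl)
...   | y∉ys ∷ _ | here refl = ⊥-elim (All.lookup y∉ys x∈ys refl)
...   | y∉ys ∷ _ | there y∈xs with pairs (refl ∷ from∈ y∈xs)
...     | _ ∷ʳ τ   = ⊥-elim (All.lookup y∉ys (Any-resp-⊆ τ (there (here refl))) refl)
...     | refl ∷ _ = ⊥-elim (All.lookup x∉xs y∈xs refl)

-- Non-ascents

-- Counting x ≥ y rather than x > y makes every pair a non-ascent in at least one direction.
nonAscent : ℕ → ℕ → ℕ
nonAscent x y with y ≤? x
... | yes _ = 1
... | no  _ = 0

nonAscent≤1 : ∀ x y → nonAscent x y ≤ 1
nonAscent≤1 x y with y ≤? x
... | yes _ = ≤-refl
... | no  _ = z≤n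

nonAscent-< : ∀ {x y} → x < y → nonAscent x y ≡ 0
nonAscent-< {x} {y} x<y with y ≤? x
... | yes y≤x = ⊥-elim (<⇒≱ x<y y≤x)
... | no  _   = refl

nonAscent-either : ∀ x y → 1 ≤ nonAscent x y + nonAscent y x
nonAscent-either x y with y ≤? x | x ≤? y
... | yes _   | _       = s≤s z≤n
... | no  _   | yes _   = s≤s z≤n
... | no  y≰x | no  x≰y with ≤-total x y
...   | inj₁ x≤y = ⊥-elim (x≰y x≤y)
...   | inj₂ y≤x = ⊥-elim (y≰x y≤x)

nonAscents : List ℕ → ℕ
nonAscents []           = 0
nonAscents (_ ∷ [])     = 0
nonAscents (x ∷ y ∷ xs) = nonAscent x y + nonAscents (y ∷ xs)

nonAscents-++ : ∀ xs ys → nonAscents (xs ++ ys) ≤ nonAscents xs + suc (nonAscents ys)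
nonAscents-++ []           ys       = n≤1+n (nonAscents ys)
nonAscents-++ (x ∷ [])     []       = z≤n
nonAscents-++ (x ∷ [])     (y ∷ ys) = +-monoˡ-≤ (nonAscents (y ∷ ys)) (nonAscent≤1 x y)
nonAscents-++ (x ∷ x′ ∷ xs) ys      = begin
  nonAscent x x′ + nonAscents (x′ ∷ xs ++ ys)                    ≤⟨ +-monoʳ-≤ (nonAscent x x′) (nonAscents-++ (x′ ∷ xs) ys) ⟩
  nonAscent x x′ + (nonAscents (x′ ∷ xs) + suc (nonAscents ys))  ≡⟨ +-assoc (nonAscent x x′) _ _ ⟨
  nonAscent x x′ + nonAscents (x′ ∷ xs) + suc (nonAscents ys)    ∎
  where open ≤-Reasoning

nonAscents-increasing : ∀ {xs} → AllPairs _<_ xs → nonAscents xs ≡ 0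
nonAscents-increasing []                      = refl
nonAscents-increasing (_ ∷ [])                = refl
nonAscents-increasing ((x<y ∷ _) ∷ ↑xs@(_ ∷ _)) = cong₂ _+_ (nonAscent-< x<y) (nonAscents-increasing ↑xs)

nonAscents-⊆-concat : ∀ {L} Ls {s} → All (AllPairs _<_) (L ∷ Ls) → s ⊆ concat (L ∷ Ls) → nonAscents s ≤ length Ls
nonAscents-⊆-concat [] (↑L ∷ []) τ =
  ≤-reflexive (nonAscents-increasing (AllPairs-resp-⊆ (subst (_ ⊆_) (++-identityʳ _) τ) ↑L))
nonAscents-⊆-concat {L} (_ ∷ Ls) (↑L ∷ ↑Ls) τ with ⊆-++-split L τ
... | s₁ , s₂ , refl , τ₁ , τ₂ = begin
  nonAscents (s₁ ++ s₂)                ≤⟨ nonAscents-++ s₁ s₂ ⟩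
  nonAscents s₁ + suc (nonAscents s₂)  ≡⟨ cong (_+ _) (nonAscents-increasing (AllPairs-resp-⊆ τ₁ ↑L)) ⟩
  suc (nonAscents s₂)                  ≤⟨ s≤s (nonAscents-⊆-concat Ls ↑Ls τ₂) ⟩
  suc (length Ls)                      ∎
  where open ≤-Reasoning

-- Each of the four letter pairs is traversed once in each direction.
nonAscents-there-and-back : ∀ b x y z → 4 ≤ nonAscents (b ∷ x ∷ y ∷ z ∷ b ∷ z ∷ y ∷ x ∷ b ∷ [])
nonAscents-there-and-back b x y z =
  subst (4 ≤_) (regroup (nonAscent b x) (nonAscent x y) (nonAscent y z) (nonAscent z b)
                        (nonAscent b z) (nonAscent z y) (nonAscent y x) (nonAscent x b))
    (+-mono-≤ (nonAscent-either b x) (+-mono-≤ (nonAscent-either x y)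
      (+-mono-≤ (nonAscent-either y z) (nonAscent-either z b))))
  where
  regroup : ∀ m₁ m₂ m₃ m₄ n₄ n₃ n₂ n₁ →
    (m₁ + n₁) + ((m₂ + n₂) + ((m₃ + n₃) + (m₄ + n₄))) ≡ m₁ + (m₂ + (m₃ + (m₄ + (n₄ + (n₃ + (n₂ + (n₁ + 0)))))))
  regroup = solve-∀

InjectiveOn : (ℕ → ℕ) → Seq → Set
InjectiveOn h u = ∀ {x y} → x ∈ u → y ∈ u → h x ≡ h y → x ≡ y

preimage : (ℕ → ℕ) → List ℕ → ℕ → ℕ
preimage g []      y = 0
preimage g (x ∷ w) y with g x ≟ y
... | yes _ = x
... | no  _ = preimage g w y

preimage-∈ : ∀ g w {y} → y ∈ map g w → preimage g w y ∈ w × g (preimage g w y) ≡ y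
preimage-∈ g (x ∷ w) {y} y∈ with g x ≟ y
... | yes gx≡y = here refl , gx≡y
preimage-∈ g (x ∷ w) (here y≡gx) | no gx≢y = ⊥-elim (gx≢y (sym y≡gx))
preimage-∈ g (x ∷ w) (there y∈) | no _ with preimage-∈ g w y∈
... | x′∈ , gx′≡y = there x′∈ , gx′≡y

map-preimage : ∀ g w → InjectiveOn g w → ∀ {ws} → (∀ {x} → x ∈ ws → x ∈ w) → map (preimage g w) (map g ws) ≡ ws
map-preimage g w g-inj {[]}     _     = refl
map-preimage g w g-inj {x ∷ ws} ws⊆w with preimage-∈ g w (∈-map⁺ g (ws⊆w (here refl)))
... | x′∈ , gx′≡gx = cong₂ _∷_ (g-inj x′∈ (ws⊆w (here refl)) gx′≡gx) (map-preimage g w g-inj (λ x∈ → ws⊆w (there x∈)))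

Contains⇒injective-image : ∀ {f u} → Contains f u → ∃[ h ] (map h u ⊆ f × InjectiveOn h u)
Contains⇒injective-image {f} (w , w⊆f , g , refl , g-inj) =
  preimage g w , subst (_⊆ f) (sym (map-preimage g w g-inj id)) w⊆f , h-inj
  where
  h-inj : InjectiveOn (preimage g w) (map g w)
  h-inj x∈ y∈ hx≡hy = trans (sym (proj₂ (preimage-∈ g w x∈))) (trans (cong g hx≡hy) (proj₂ (preimage-∈ g w y∈)))

InjectiveOn-map-∉ : ∀ {h u w a} → InjectiveOn h u → a ∈ u → (∀ {x} → x ∈ w → x ∈ u) → a ∉ w → h a ∉ map h w
InjectiveOn-map-∉ {h} h-inj a∈u w⊆u a∉w ha∈ with ∈-map⁻ h ha∈
... | x , x∈w , ha≡hx = a∉w (subst (_∈ _) (h-inj (w⊆u x∈w) a∈u (sym ha≡hx)) x∈w)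

Contains-resp-⊆ : ∀ {f f′ u} → f ⊆ f′ → Contains f u → Contains f′ u
Contains-resp-⊆ f⊆f′ (w , w⊆f , rest) = w , ⊆-trans w⊆f f⊆f′ , rest

sandwich : ℕ → Seq → Seq → Seq
sandwich a v v' = a ∷ v ++ a ∷ v' ++ [ a ]

map-sandwich : ∀ h a v v' → map h (sandwich a v v') ≡ sandwich (h a) (map h v) (map h v')
map-sandwich h a v v' = cong (h a ∷_) (trans (map-++ h v (a ∷ v' ++ [ a ])) (cong (λ l → map h v ++ h a ∷ l) (map-++ h v' [ a ])))

-- Ways in which v' may reorder v

ReversedTriple : Seq → Seq → Set
ReversedTriple v v' = ∃[ x ] ∃[ y ] ∃[ z ] (x ∷ y ∷ z ∷ [] ⊆ v × z ∷ y ∷ x ∷ [] ⊆ v')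

Peak : Seq → Seq → Set
Peak v v' = ∃[ p ] ∃[ q ] ∃[ r ] (p ∷ q ∷ r ∷ [] ⊆ v × p ∷ q ∷ [] ⊆ v' × r ∷ q ∷ [] ⊆ v')

Valley : Seq → Seq → Set
Valley v v' = ∃[ c ] ∃[ d ] ∃[ e ] (c ∷ d ∷ e ∷ [] ⊆ v' × d ∷ c ∷ [] ⊆ v × d ∷ e ∷ [] ⊆ v)

¬Peak⇒MoveFirst : ∀ v {v'} → 0 < length v → Unique v → v' ↭ v →
  ¬ ReversedTriple v v' → ¬ Peak v v' → MoveFirst v v'
¬Peak⇒MoveFirst (x ∷ rest) _ (x∉rest ∷ urest) v'↭v ¬rev ¬peak with ∈-∃++ (∈-resp-↭ (↭-sym v'↭v) (here refl))
... | ys , zs , refl =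
  x , ys , zs , cong (x ∷_) (↭-pairs-preserved⇒≡ urest (↭-sym (drop-mid ys [] v'↭v)) pairs) , refl
  where
  pairs : ∀ {q r} → q ∷ r ∷ [] ⊆ rest → q ∷ r ∷ [] ⊆ ys ++ zs
  pairs {q} {r} τ = ⊆-remove-pivot ys (λ { (here x≡q) → x≢q x≡q ; (there (here x≡r)) → x≢r x≡r }) qr
    where
    q∈ = Any-resp-⊆ τ (here refl)
    r∈ = Any-resp-⊆ τ (there (here refl))
    x≢q = All.lookup x∉rest q∈
    x≢r = All.lookup x∉rest r∈
    xqr⊆v : x ∷ q ∷ r ∷ [] ⊆ x ∷ rest
    xqr⊆v = refl ∷ τ
    qr : q ∷ r ∷ [] ⊆ ys ++ x ∷ zs
    qr with order₃ (∈-resp-↭ (↭-sym v'↭v) (here refl)) (∈-resp-↭ (↭-sym v'↭v) (there q∈))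
                   (∈-resp-↭ (↭-sym v'↭v) (there r∈)) x≢q x≢r (AllPairs-pair τ urest)
    ... | xyz σ = ∷ˡ⁻ σ
    ... | yxz σ = ⊆-skip-middle σ
    ... | yzx σ = ⊆-drop-last σ
    ... | xzy σ = ⊥-elim (¬peak (x , q , r , xqr⊆v , ⊆-skip-middle σ , ∷ˡ⁻ σ))
    ... | zxy σ = ⊥-elim (¬peak (x , q , r , xqr⊆v , ∷ˡ⁻ σ , ⊆-skip-middle σ))
    ... | zyx σ = ⊥-elim (¬rev (x , q , r , xqr⊆v , σ))

¬Valley⇒MoveToEnd : ∀ v {v'} → 0 < length v → Unique v → v' ↭ v →
  ¬ ReversedTriple v v' → ¬ Valley v v' → MoveToEnd v v'
¬Valley⇒MoveToEnd v {v'} 0<∣v∣ uv v'↭v ¬rev ¬valley with initLast v'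
... | [] = ⊥-elim (<-irrefl (↭-length v'↭v) 0<∣v∣)
... | init ∷ʳ′ y with ∈-∃++ (∈-resp-↭ v'↭v (∈-++⁺ʳ init (here refl)))
...   | ys , zs , refl =
  ys , y , zs , refl , trans (cong (_++ [ y ]) (↭-pairs-preserved⇒≡ uinit init↭ pairs)) (++-assoc ys zs [ y ])
  where
  uv' = Unique-resp-↭ (↭-sym v'↭v) uv
  uinit = AllPairs-resp-⊆ (++⁺ʳ [ y ] ⊆-refl) uv'
  init↭ = ↭-trans (↭-sym (↭-++-identityʳ init)) (drop-mid init ys v'↭v)
  pairs : ∀ {c e} → c ∷ e ∷ [] ⊆ init → c ∷ e ∷ [] ⊆ ys ++ zs
  pairs {c} {e} τ = ⊆-remove-pivot ys (λ { (here y≡c) → c≢y (sym y≡c) ; (there (here y≡e)) → e≢y (sym y≡e) }) ce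
    where
    c∈ = Any-resp-⊆ τ (here refl)
    e∈ = Any-resp-⊆ τ (there (here refl))
    c≢y = AllPairs-pair (++⁺ (from∈ c∈) ⊆-refl) uv'
    e≢y = AllPairs-pair (++⁺ (from∈ e∈) ⊆-refl) uv'
    cey⊆v' : c ∷ e ∷ y ∷ [] ⊆ init ++ [ y ]
    cey⊆v' = ++⁺ τ ⊆-refl
    ce : c ∷ e ∷ [] ⊆ ys ++ y ∷ zs
    ce with order₃ (∈-resp-↭ v'↭v (∈-++⁺ˡ c∈)) (∈-resp-↭ v'↭v (∈-++⁺ˡ e∈))
                   (∈-resp-↭ v'↭v (∈-++⁺ʳ init (here refl))) (AllPairs-pair τ uinit) c≢y e≢y
    ... | xyz σ = ⊆-drop-last σ
    ... | xzy σ = ⊆-skip-middle σ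
    ... | zxy σ = ∷ˡ⁻ σ
    ... | yxz σ = ⊥-elim (¬valley (c , e , y , cey⊆v' , ⊆-drop-last σ , ⊆-skip-middle σ))
    ... | yzx σ = ⊥-elim (¬valley (c , e , y , cey⊆v' , ⊆-skip-middle σ , ⊆-drop-last σ))
    ... | zyx σ = ⊥-elim (¬rev (y , e , c , σ , cey⊆v'))

Peak-map : ∀ h {v v'} → Peak v v' → Peak (map h v) (map h v')
Peak-map h (p , q , r , τ₁ , τ₂ , τ₃) = h p , h q , h r , map⁺ h τ₁ , map⁺ h τ₂ , map⁺ h τ₃

Valley-map : ∀ h {v v'} → Valley v v' → Valley (map h v) (map h v')
Valley-map h (c , d , e , τ₁ , τ₂ , τ₃) = h c , h d , h e , map⁺ h τ₁ , map⁺ h τ₂ , map⁺ h τ₃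

-- The formations L L L L and L R R L

increasing⁴-¬ReversedTriple : ∀ {L a v v'} → AllPairs _<_ L →
  Contains (concat (L ∷ L ∷ L ∷ L ∷ [])) (sandwich a v v') → ¬ ReversedTriple v v'
increasing⁴-¬ReversedTriple {L} {a} {v} {v'} ↑L c (x , y , z , xyz⊆v , zyx⊆v') with Contains⇒injective-image c
... | h , hu⊆ , _ =
  <⇒≱ (s≤s (nonAscents-⊆-concat (L ∷ L ∷ L ∷ []) (↑L ∷ ↑L ∷ ↑L ∷ ↑L ∷ []) pattern⊆))
      (nonAscents-there-and-back (h a) (h x) (h y) (h z))
  where
  pattern⊆ : h a ∷ h x ∷ h y ∷ h z ∷ h a ∷ h z ∷ h y ∷ h x ∷ h a ∷ [] ⊆ concat (L ∷ L ∷ L ∷ L ∷ [])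
  pattern⊆ = ⊆-trans (refl ∷ ++⁺ (map⁺ h xyz⊆v) (refl ∷ ++⁺ (map⁺ h zyx⊆v') ⊆-refl))
                     (subst (_⊆ concat (L ∷ L ∷ L ∷ L ∷ [])) (map-sandwich h a v v') hu⊆)

module _ {b : ℕ} {A B C D : List ℕ}
         (A<b : All (_< b) A) (b<B : All (b <_) B) (b<C : All (b <_) C) (D<b : All (_< b) D) where

  above⇒⊆C : ∀ {x y} → x ∷ y ∷ [] ⊆ D ++ C ++ D ++ A → b < x → b < y → x ∷ y ∷ [] ⊆ C
  above⇒⊆C τ b<x b<y = ⊆-++-middle <-asym D D<b (All.++⁺ D<b A<b) (b<x ∷ b<y ∷ []) τ

  below⇒⊆D : ∀ {x y} → x ∷ y ∷ [] ⊆ (B ++ C) ++ D ++ C → x < b → y < b → x ∷ y ∷ [] ⊆ D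
  below⇒⊆D τ x<b y<b = ⊆-++-middle <-asym (B ++ C) (All.++⁺ b<B b<C) b<C (x<b ∷ y<b ∷ []) τ

  ¬Peak-up-down : AllPairs _<_ B → AllPairs _>_ C → ∀ {w₁ w₂} →
    w₁ ⊆ B ++ C → w₂ ⊆ D ++ C ++ D ++ A → ¬ Peak w₁ w₂
  ¬Peak-up-down ↑B ↓C w₁⊆ w₂⊆ (p , q , r , pqr⊆ , pq⊆ , rq⊆)
    with All-resp-⊆ (⊆-trans pqr⊆ w₁⊆) (All.++⁺ b<B b<C) | triple-⊆-++ B (⊆-trans pqr⊆ w₁⊆)
  ... | b<p ∷ b<q ∷ b<r ∷ [] | inj₁ pq⊆B =
    <-asym (AllPairs-pair pq⊆B ↑B) (AllPairs-pair (above⇒⊆C (⊆-trans pq⊆ w₂⊆) b<p b<q) ↓C)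
  ... | b<p ∷ b<q ∷ b<r ∷ [] | inj₂ qr⊆C =
    <-asym (AllPairs-pair qr⊆C ↓C) (AllPairs-pair (above⇒⊆C (⊆-trans rq⊆ w₂⊆) b<r b<q) ↓C)

  ¬Valley-down-up : AllPairs _>_ D → AllPairs _<_ A → ∀ {w₁ w₂} →
    w₁ ⊆ (B ++ C) ++ D ++ C → w₂ ⊆ D ++ A → ¬ Valley w₁ w₂
  ¬Valley-down-up ↓D ↑A w₁⊆ w₂⊆ (c , d , e , cde⊆ , dc⊆ , de⊆)
    with All-resp-⊆ (⊆-trans cde⊆ w₂⊆) (All.++⁺ D<b A<b) | triple-⊆-++ D (⊆-trans cde⊆ w₂⊆)
  ... | c<b ∷ d<b ∷ e<b ∷ [] | inj₁ cd⊆D =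
    <-asym (AllPairs-pair cd⊆D ↓D) (AllPairs-pair (below⇒⊆D (⊆-trans dc⊆ w₁⊆) d<b c<b) ↓D)
  ... | c<b ∷ d<b ∷ e<b ∷ [] | inj₂ de⊆A =
    <-asym (AllPairs-pair de⊆A ↑A) (AllPairs-pair (below⇒⊆D (⊆-trans de⊆ w₁⊆) d<b e<b) ↓D)

LRRL-around-pivots : ∀ A B C D (b : ℕ) →
  concat ((A ++ b ∷ B) ∷ (C ++ b ∷ D) ∷ (C ++ b ∷ D) ∷ (A ++ b ∷ B) ∷ []) ≡
  A ++ b ∷ (B ++ C) ++ b ∷ (D ++ C) ++ b ∷ (D ++ A) ++ b ∷ B
LRRL-around-pivots A B C D b =
  solve 5 (λ A B C D b → (A ⊕ (b ⊕ B)) ⊕ ((C ⊕ (b ⊕ D)) ⊕ ((C ⊕ (b ⊕ D)) ⊕ ((A ⊕ (b ⊕ B)) ⊕ ε)))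
                       ⊜ A ⊕ (b ⊕ ((B ⊕ C) ⊕ (b ⊕ ((D ⊕ C) ⊕ (b ⊕ ((D ⊕ A) ⊕ (b ⊕ B))))))))
    refl A B C D [ b ]

All-<⇒∉ : ∀ {b xs} → All (_< b) xs → b ∉ xs
All-<⇒∉ xs<b b∈ = <-irrefl refl (All.lookup xs<b b∈)

All->⇒∉ : ∀ {b xs} → All (b <_) xs → b ∉ xs
All->⇒∉ b<xs b∈ = <-irrefl refl (All.lookup b<xs b∈)

LRRL-¬Peak×Valley : ∀ {L R a v v'} → AllPairs _<_ L → AllPairs _>_ R → R ↭ L → a ∉ v → a ∉ v' →
  Contains (concat (L ∷ R ∷ R ∷ L ∷ [])) (sandwich a v v') → Peak v v' → Valley v v' → ⊥
LRRL-¬Peak×Valley {L} {R} {a} {v} {v'} ↑L ↓R R↭L a∉v a∉v' c peak valley with Contains⇒injective-image c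
... | h , hu⊆ , h-inj with ∈-concat-↭ (↭-refl ∷ R↭L ∷ R↭L ∷ ↭-refl ∷ []) (Any-resp-⊆ hu⊆ (here refl))
... | b∈L with AllPairs-split ↑L b∈L | AllPairs-split ↓R (∈-resp-↭ (↭-sym R↭L) b∈L)
... | A , B , refl , A<b , b<B , ↑A , ↑B | C , D , refl , b<C , D<b , ↓C , ↓D
  with ⊆-four-pivots A (B ++ C) (D ++ C) (D ++ A)
         (InjectiveOn-map-∉ h-inj (here refl) (λ x∈ → there (∈-++⁺ˡ x∈)) a∉v)
         (InjectiveOn-map-∉ h-inj (here refl) (λ x∈ → there (∈-++⁺ʳ v (there (∈-++⁺ˡ x∈)))) a∉v')
         (All-<⇒∉ A<b) (∉-++ (All->⇒∉ b<B) (All->⇒∉ b<C)) (∉-++ (All-<⇒∉ D<b) (All->⇒∉ b<C))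
         (∉-++ (All-<⇒∉ D<b) (All-<⇒∉ A<b)) (All->⇒∉ b<B)
         (subst₂ _⊆_ (map-sandwich h a v v') (LRRL-around-pivots A B C D (h a)) hu⊆)
... | inj₁ (w₁⊆ , w₂⊆) =
  ¬Peak-up-down A<b b<B b<C D<b ↑B ↓C w₁⊆ (subst (_ ⊆_) (++-assoc D C (D ++ A)) w₂⊆) (Peak-map h peak)
... | inj₂ (w₁⊆ , w₂⊆) = ¬Valley-down-up A<b b<B b<C D<b ↓D ↑A w₁⊆ w₂⊆ (Valley-map h valley)

concat-take-⊆ : ∀ n (ps : List Seq) → concat (take n ps) ⊆ concat ps
concat-take-⊆ n ps = subst (concat (take n ps) ⊆_)
  (trans (concat-++ (take n ps) (drop n ps)) (cong concat (take++drop≡id n ps))) (++⁺ʳ _ ⊆-refl)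

AllFormationsContain⇒concat : ∀ {r s u L ps} → AllFormationsContain r s u → length L ≡ r → Unique L →
  All (_↭ L) ps → s ≤ length ps → Contains (concat ps) u
AllFormationsContain⇒concat {s = s} {L = L} {ps} every ∣L∣≡r uL ps↭L s≤∣ps∣ =
  Contains-resp-⊆ (concat-take-⊆ s ps) (every _
    (L , ∣L∣≡r , uL , take s ps , trans (length-take s ps) (m≤n⇒m⊓n≡m s≤∣ps∣) , All.take⁺ s ps↭L , refl))

lemma4p4 : (a : ℕ) (v v' : Seq) →
    length v > 0 → a ∉ v → Unique v → v' ↭ v →
    ¬ MoveFirst v v' → ¬ MoveToEnd v v' →
    FwGreaterThan (a ∷ v ++ a ∷ v' ++ [ a ]) 4
lemma4p4 a v v' 0<∣v∣ a∉v uv v'↭v ¬first ¬end (s , s≤4 , r , every) =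
  ¬end (¬Valley⇒MoveToEnd v 0<∣v∣ uv v'↭v ¬rev λ valley →
  ¬first (¬Peak⇒MoveFirst v 0<∣v∣ uv v'↭v ¬rev λ peak →
  LRRL-¬Peak×Valley ↑L ↓R R↭L a∉v (λ a∈v' → a∉v (∈-resp-↭ v'↭v a∈v'))
    (contains (↭-refl ∷ R↭L ∷ R↭L ∷ ↭-refl ∷ []) s≤4) peak valley))
  where
  L = upTo r
  R = downFrom r
  ↑L : AllPairs _<_ L
  ↑L = AllPairs.applyUpTo⁺₁ id r (λ i<j _ → i<j)
  ↓R : AllPairs _>_ R
  ↓R = AllPairs.applyDownFrom⁺₁ id r (λ j<i _ → j<i)
  R↭L : R ↭ L
  R↭L = subst (_↭ L) (reverse-upTo r) (↭-reverse L)
  contains : ∀ {ps} → All (_↭ L) ps → s ≤ length ps → Contains (concat ps) (sandwich a v v')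
  contains = AllFormationsContain⇒concat every (length-upTo r) (upTo⁺ r)
  ¬rev : ¬ ReversedTriple v v'
  ¬rev = increasing⁴-¬ReversedTriple ↑L (contains (↭-refl ∷ ↭-refl ∷ ↭-refl ∷ ↭-refl ∷ []) s≤4)
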